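{- Let $k,l,d$ be nonnegative integers with $k\le 3$, $l\le 2^k$, $d\ge l+k$, and such that $l\ne 4$ if $k=3$. Then every level-$l$ $k$-cube in $Q^d$ is $\mathbf{0}$-stackable. In particular, $Q^d$ is stackable for all $d\le 6$.
   Context: $Q^d$ has vertex set $\{0,1\}^d$, adjacency meaning differing in exactly one coordinate; $\mathbf{0}$ is the all-zeros vertex. Writing $Q^d=Q^{d-k}\,\square\,Q^k$, for each $S\subseteq\{1,\dots,d-k\}$ the $k$-cube labeled $S$ is the set of vertices whose first $d-k$ coordinates are the indicator vector of $S$ (last $k$ coordinates arbitrary); its level is $|S|$. A configuration is a function $C:V\to\mathbb{N}$ (numbers of cups); a cup stacking move from $u$ to $v$ is allowed when $C(u)\ge1$, $C(v)\ge1$ and $\mathrm{dist}_{Q^d}(u,v)=C(u)$, and moves all cups of $u$ onto $v$. A set $U$ of vertices of $Q^d$ is $\mathbf{0}$-stackable if, starting from the configuration with one cup on each vertex of $U\cup\{\mathbf{0}\}$ and none elsewhere, some sequence of moves in $Q^d$ puts all cups on $\mathbf{0}$. $G$ is stackable if for every vertex $r$, starting with one cup on every vertex, some sequence of moves puts all cups on $r$. -}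

module Defs where

open import Data.Bool using (Bool; true; false; _∨_; _≟_; if_then_else_)
open import Data.Product using (∃; _×_)
open import Data.Nat using (ℕ; zero; suc; _+_; _≤_)
open import Data.Vec using (Vec; []; _∷_; replicate; toList)
import Data.Vec.Properties as VecP
import Data.List as L
import Data.List.Properties as ListP
open import Relation.Nullary using (yes; no; ¬_; does)
open import Relation.Binary.PropositionalEquality using (_≡_)
open import Relation.Binary.Construct.Closure.ReflexiveTransitive using (Star)

-- Vertices of the hypercube Q^d : {0,1}^d, with 1 read as true.
Vertex : ℕ → Set
Vertex d = Vec Bool d

𝟎 : ∀ {d} → Vertex d
𝟎 {d} = replicate d false

-- Graph distance in Q^d = Hamming distance.
hamming : ∀ {d} → Vertex d → Vertex d → ℕ
hamming [] [] = 0
hamming (x ∷ xs) (y ∷ ys) = (if does (x ≟ y) then 0 else 1) + hamming xs ys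

_≟V_ : ∀ {d} (u v : Vertex d) → Relation.Nullary.Dec (u ≡ v)
_≟V_ = VecP.≡-dec _≟_

-- Configurations: number of cups on each vertex.
Config : ℕ → Set
Config d = Vertex d → ℕ

move : ∀ {d} → Config d → Vertex d → Vertex d → Config d
move C u v w with does (w ≟V u) | does (w ≟V v)
... | true  | _     = 0
... | false | true  = C v + C u
... | false | false = C w

data Step {d : ℕ} : Config d → Config d → Set where
  step : (C : Config d) (u v : Vertex d) →
         1 ≤ C u → 1 ≤ C v → hamming u v ≡ C u →
         Step C (move C u v)

Reach : ∀ {d} → Config d → Config d → Set
Reach = Star Step

AllOn : ∀ {d} → Vertex d → Config d → Set
AllOn r C = ∀ w → ¬ (w ≡ r) → C w ≡ 0

-- Subsets of the vertex set, as characteristic functions.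
VSet : ℕ → Set
VSet d = Vertex d → Bool

initConfig : ∀ {d} → VSet d → Config d
initConfig U w = if (U w ∨ does (w ≟V 𝟎)) then 1 else 0

ZeroStackable : ∀ {d} → VSet d → Set
ZeroStackable {d} U = ∃ λ (C : Config d) → Reach (initConfig U) C × AllOn 𝟎 C

Stackable : ℕ → Set
Stackable d = ∀ (r : Vertex d) → ∃ λ (C : Config d) → Reach (λ _ → 1) C × AllOn r C

-- Number of true entries (= |S| for an indicator vector).
level : ∀ {n} → Vec Bool n → ℕ
level [] = 0
level (true ∷ s) = suc (level s)
level (false ∷ s) = level s

-- Writing Q^d = Q^(d-k) □ Q^k, the k-cube labeled by the indicator vector s of
-- S ⊆ {1,…,d-k}: vertices whose first d-k coordinates equal s.
-- (Here s : Vec Bool j with j = d ∸ k; membership compares the length-j prefix.)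
kCube : ∀ {j d} → Vec Bool j → VSet d
kCube {j} s v = does (ListP.≡-dec _≟_ (L.take j (toList v)) (toList s))

-- A stacking problem only involves the cup counts on the occupied vertices and their mutual
-- distances, so a play can be carried out on an abstract finite distance space and transported
-- into Q^d along any isometric embedding.  For l ≥ 1, 𝟎 together with a level-l k-cube is such
-- a space, independent of d and of the label: Q^k plus an apex at distance l + |x| from each x.
-- So each admissible (k, l) is settled by one explicit play on it, verified by evaluation.  At
-- level 0 the cube is a copy of Q^k containing 𝟎; that case, and the stackability of Q^d for
-- d ≤ 6, reduce to plays gathering all cups of Q^n onto 𝟎, moved to an arbitrary root r by the
-- translation x ↦ r ⊕ x.
module Submission where

open import Defs
open import Data.Bool using (Bool; true; false; not; _∨_; _xor_; if_then_else_)
  renaming (_≟_ to _≟B_)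
open import Data.Bool.Properties using (∨-zeroʳ; not-involutive; xor-identityʳ)
open import Data.Nat using (ℕ; zero; suc; _+_; _∸_; _^_; _≤_; _≤?_; z≤n; s≤s; _/_; _%_; _≡ᵇ_)
  renaming (_≟_ to _≟ℕ_)
open import Data.Nat.Properties using (m∸n+n≡m; ≤-trans; m≤n+m; m≤m+n)
open import Data.Vec using (Vec; []; _∷_; _++_; _∷ʳ_; toList; zipWith)
open import Data.Vec.Properties using (∷-injectiveʳ; ++-injectiveʳ; zipWith-identityʳ)
open import Data.Maybe using (Maybe; nothing; just)
import Data.Maybe as Maybe
import Data.Maybe.Properties as MaybeP
open import Data.List using (List; []; _∷_)
import Data.List as List
import Data.List.Properties as ListP
open import Data.Product using (_×_; _,_; ∃; proj₂)
import Data.Product as Product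
open import Data.Sum using (_⊎_; inj₁; inj₂)
open import Data.Unit using (⊤)
open import Data.Empty using (⊥-elim)
open import Function using (_∘_)
open import Function.Definitions using (Injective)
open import Relation.Nullary using (Dec; yes; no; does; contradiction)
open import Relation.Nullary.Decidable
  using (True; toWitness; map′; _×-dec_; _→-dec_; ¬?; dec-true; dec-false)
open import Relation.Unary using (Decidable)
open import Relation.Binary.Definitions using (DecidableEquality)
open import Relation.Binary.PropositionalEquality
  using (_≡_; _≢_; refl; sym; trans; cong; cong₂; subst; module ≡-Reasoning)
open import Relation.Binary.Construct.Closure.ReflexiveTransitive using (ε; _◅_)

module _ {d : ℕ} (C : Config d) (u v : Vertex d) where

  move-source : move C u v u ≡ 0
  move-source with u ≟V u
  ... | yes _   = refl
  ... | no u≢u  = ⊥-elim (u≢u refl)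

  move-target : u ≢ v → move C u v v ≡ C v + C u
  move-target u≢v with v ≟V u | v ≟V v
  ... | yes v≡u | _       = ⊥-elim (u≢v (sym v≡u))
  ... | no _    | yes _   = refl
  ... | no _    | no v≢v  = ⊥-elim (v≢v refl)

  move-other : ∀ {w} → w ≢ u → w ≢ v → move C u v w ≡ C w
  move-other {w} w≢u w≢v with w ≟V u | w ≟V v
  ... | yes w≡u | _       = ⊥-elim (w≢u w≡u)
  ... | no _    | yes w≡v = ⊥-elim (w≢v w≡v)
  ... | no _    | no _    = refl

module _ {d : ℕ} (U : VSet d) where

  initConfig-occupied : ∀ {w} → U w ≡ true ⊎ w ≡ 𝟎 → initConfig U w ≡ 1
  initConfig-occupied (inj₁ Uw≡true) rewrite Uw≡true = refl
  initConfig-occupied (inj₂ refl) =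
    cong (if_then 1 else 0) (trans (cong (U 𝟎 ∨_) (dec-true (𝟎 {d} ≟V 𝟎) refl)) (∨-zeroʳ (U 𝟎)))

  initConfig-support : ∀ w → initConfig U w ≢ 0 → U w ≡ true ⊎ w ≡ 𝟎
  initConfig-support w c≢0 with U w | w ≟V 𝟎
  ... | true  | _       = inj₁ refl
  ... | false | yes w≡𝟎 = inj₂ w≡𝟎
  ... | false | no _    = ⊥-elim (c≢0 refl)

hamming-self : ∀ {n} (u : Vertex n) → hamming u u ≡ 0
hamming-self []          = refl
hamming-self (true ∷ u)  = hamming-self u
hamming-self (false ∷ u) = hamming-self u

Exhaustible : Set → Set₁
Exhaustible A = ∀ {P : A → Set} → Decidable P → Dec (∀ x → P x)

Bool-exhaustible : Exhaustible Bool
Bool-exhaustible P? =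
  map′ (λ (t , f) → λ { true → t ; false → f }) (λ h → h true , h false)
       (P? true ×-dec P? false)

Vec-exhaustible : ∀ {A} → Exhaustible A → ∀ n → Exhaustible (Vec A n)
Vec-exhaustible A? zero P? = map′ (λ p → λ { [] → p }) (λ h → h []) (P? [])
Vec-exhaustible A? (suc n) P? =
  map′ (λ h → λ { (x ∷ xs) → h x xs }) (λ h x xs → h (x ∷ xs))
       (A? λ x → Vec-exhaustible A? n (P? ∘ (x ∷_)))

Maybe-exhaustible : ∀ {A} → Exhaustible A → Exhaustible (Maybe A)
Maybe-exhaustible A? P? =
  map′ (λ (n , j) → λ { nothing → n ; (just x) → j x }) (λ h → h nothing , h ∘ just)
       (P? nothing ×-dec A? (P? ∘ just))

-- Cup stacking on a finite distance space

record DistanceSpace : Set₁ where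
  field
    Point      : Set
    _≟_        : DecidableEquality Point
    exhaustive : Exhaustible Point
    dist       : Point → Point → ℕ

module CupStacking (X : DistanceSpace) where
  open DistanceSpace X

  Cups : Set
  Cups = Point → ℕ

  oneEach : Cups
  oneEach _ = 1

  shift : Cups → Point → Point → Cups
  shift M p q r = if does (r ≟ p) then 0 else if does (r ≟ q) then M q + M p else M r

  shift-source : ∀ M p q → shift M p q p ≡ 0
  shift-source M p q rewrite dec-true (p ≟ p) refl = refl

  shift-target : ∀ M p q → q ≢ p → shift M p q q ≡ M q + M p
  shift-target M p q q≢p rewrite dec-false (q ≟ p) q≢p | dec-true (q ≟ q) refl = refl

  shift-other : ∀ M p q {r} → r ≢ p → r ≢ q → shift M p q r ≡ M r
  shift-other M p q {r} r≢p r≢q rewrite dec-false (r ≟ p) r≢p | dec-false (r ≟ q) r≢q = refl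

  Play : Set
  Play = List (Point × Point)

  run : Cups → Play → Cups
  run M []             = M
  run M ((p , q) ∷ ms) = run (shift M p q) ms

  record LegalMove (M : Cups) (p q : Point) : Set where
    field
      source-occupied : 1 ≤ M p
      target-occupied : 1 ≤ M q
      dist≡cups       : dist p q ≡ M p

  legalMove? : ∀ M p q → Dec (LegalMove M p q)
  legalMove? M p q =
    map′ (λ (s , t , d) → record { source-occupied = s ; target-occupied = t ; dist≡cups = d })
         (λ m → LegalMove.source-occupied m , LegalMove.target-occupied m , LegalMove.dist≡cups m)
         (1 ≤? M p ×-dec 1 ≤? M q ×-dec dist p q ≟ℕ M p)

  Legal : Cups → Play → Set
  Legal M []             = ⊤
  Legal M ((p , q) ∷ ms) = LegalMove M p q × Legal (shift M p q) ms

  legal? : ∀ M ms → Dec (Legal M ms)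
  legal? M [] = yes _
  legal? M ((p , q) ∷ ms) = legalMove? M p q ×-dec legal? (shift M p q) ms

  Gathered : Point → Cups → Set
  Gathered z M = ∀ p → p ≢ z → M p ≡ 0

  record Wins (z : Point) (ms : Play) : Set where
    field
      legal    : Legal oneEach ms
      gathered : Gathered z (run oneEach ms)
  open Wins

  wins? : ∀ z ms → Dec (Wins z ms)
  wins? z ms = map′ (λ (l , g) → record { legal = l ; gathered = g }) (λ w → legal w , gathered w)
    (legal? oneEach ms ×-dec exhaustive (λ p → ¬? (p ≟ z) →-dec run oneEach ms p ≟ℕ 0))

  wins : ∀ z ms → {True (wins? z ms)} → Wins z ms
  wins z ms {w} = toWitness w

  record Represents {d} (f : Point → Vertex d) (C : Config d) (M : Cups) : Set where
    field
      agrees        : ∀ p → C (f p) ≡ M p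
      support⊆image : ∀ w → C w ≢ 0 → ∃ λ p → f p ≡ w

  represents-initConfig : ∀ {d} (f : Point → Vertex d) (U : VSet d) →
                          (∀ p → U (f p) ≡ true ⊎ f p ≡ 𝟎) →
                          (∀ w → U w ≡ true ⊎ w ≡ 𝟎 → ∃ λ p → f p ≡ w) →
                          Represents f (initConfig U) oneEach
  represents-initConfig f U image⊆ ⊆image = record
    { agrees        = λ p → initConfig-occupied U (image⊆ p)
    ; support⊆image = λ w c≢0 → ⊆image w (initConfig-support U w c≢0)
    }

  record IsometricEmbedding (d : ℕ) : Set where
    field
      embed     : Point → Vertex d
      injective : Injective _≡_ _≡_ embed
      isometric : ∀ p q → hamming (embed p) (embed q) ≡ dist p q

  module Simulation {d} (e : IsometricEmbedding d) where
    open IsometricEmbedding e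

    module _ {C M p q} (rep : Represents embed C M) (legal : LegalMove M p q) where
      open Represents rep
      open LegalMove legal

      hamming≡cups : hamming (embed p) (embed q) ≡ C (embed p)
      hamming≡cups = trans (isometric p q) (trans dist≡cups (sym (agrees p)))

      embed-distinct : embed p ≢ embed q
      embed-distinct eq = contradiction (subst (1 ≤_) Mp≡0 source-occupied) λ ()
        where
        open ≡-Reasoning
        Mp≡0 : M p ≡ 0
        Mp≡0 = begin
          M p                          ≡⟨ sym dist≡cups ⟩
          dist p q                     ≡⟨ sym (isometric p q) ⟩
          hamming (embed p) (embed q)  ≡⟨ cong (hamming (embed p)) (sym eq) ⟩
          hamming (embed p) (embed p)  ≡⟨ hamming-self (embed p) ⟩
          0                            ∎

      step-embedded : Step C (move C (embed p) (embed q))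
      step-embedded = step C (embed p) (embed q)
        (subst (1 ≤_) (sym (agrees p)) source-occupied) (subst (1 ≤_) (sym (agrees q)) target-occupied)
        hamming≡cups

      represents-move : Represents embed (move C (embed p) (embed q)) (shift M p q)
      represents-move = record { agrees = agrees′ ; support⊆image = support⊆image′ }
        where
        agrees′ : ∀ r → move C (embed p) (embed q) (embed r) ≡ shift M p q r
        agrees′ r = by-cases (r ≟ p) (r ≟ q)
          where
          open ≡-Reasoning
          by-cases : Dec (r ≡ p) → Dec (r ≡ q) → move C (embed p) (embed q) (embed r) ≡ shift M p q r
          by-cases (yes refl) _ = trans (move-source C (embed p) (embed q)) (sym (shift-source M p q))
          by-cases (no r≢p) (yes refl) = begin
            move C (embed p) (embed q) (embed q) ≡⟨ move-target C (embed p) (embed q) embed-distinct ⟩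
            C (embed q) + C (embed p)            ≡⟨ cong₂ _+_ (agrees q) (agrees p) ⟩
            M q + M p                            ≡⟨ sym (shift-target M p q r≢p) ⟩
            shift M p q q                        ∎
          by-cases (no r≢p) (no r≢q) = begin
            move C (embed p) (embed q) (embed r) ≡⟨ move-other C (embed p) (embed q)
                                                      (r≢p ∘ injective) (r≢q ∘ injective) ⟩
            C (embed r)                          ≡⟨ agrees r ⟩
            M r                                  ≡⟨ sym (shift-other M p q r≢p r≢q) ⟩
            shift M p q r                        ∎

        support⊆image′ : ∀ w → move C (embed p) (embed q) w ≢ 0 → ∃ λ r → embed r ≡ w
        support⊆image′ w c≢0 = by-cases (w ≟V embed p) (w ≟V embed q)
          where
          by-cases : Dec (w ≡ embed p) → Dec (w ≡ embed q) → ∃ λ r → embed r ≡ w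
          by-cases (yes refl) _          = ⊥-elim (c≢0 (move-source C (embed p) (embed q)))
          by-cases (no _)     (yes refl) = q , refl
          by-cases (no w≢p)   (no w≢q)   =
            support⊆image w (c≢0 ∘ trans (move-other C (embed p) (embed q) w≢p w≢q))

    simulate : ∀ {C M} ms → Legal M ms → Represents embed C M →
               ∃ λ C′ → Reach C C′ × Represents embed C′ (run M ms)
    simulate []             _                 rep = _ , ε , rep
    simulate ((p , q) ∷ ms) (legal , legals) rep =
      let C′ , reach , rep′ = simulate ms legals (represents-move rep legal)
      in  C′ , step-embedded rep legal ◅ reach , rep′

    represents-gathered : ∀ {C M z} → Represents embed C M → Gathered z M → AllOn (embed z) C
    represents-gathered {C} {M} {z} rep gathered w w≢z with C w ≟ℕ 0
    ... | yes Cw≡0 = Cw≡0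
    ... | no Cw≢0 with Represents.support⊆image rep w Cw≢0
    ...   | p , refl = trans (Represents.agrees rep p) (gathered p (w≢z ∘ cong embed))

    stack : ∀ {C z ms} → Wins z ms → Represents embed C oneEach →
            ∃ λ C′ → Reach C C′ × AllOn (embed z) C′
    stack {ms = ms} win rep =
      let C′ , reach , rep′ = simulate ms (Wins.legal win) rep
      in  C′ , reach , represents-gathered rep′ (Wins.gathered win)

hamming-++ : ∀ {j k} (s : Vertex j) (x y : Vertex k) → hamming (s ++ x) (s ++ y) ≡ hamming x y
hamming-++ []          x y = refl
hamming-++ (true ∷ s)  x y = hamming-++ s x y
hamming-++ (false ∷ s) x y = hamming-++ s x y

hamming-𝟎ʳ : ∀ {n} (v : Vertex n) → hamming v 𝟎 ≡ level v
hamming-𝟎ʳ []          = refl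
hamming-𝟎ʳ (true ∷ v)  = cong suc (hamming-𝟎ʳ v)
hamming-𝟎ʳ (false ∷ v) = hamming-𝟎ʳ v

hamming-𝟎ˡ : ∀ {n} (v : Vertex n) → hamming 𝟎 v ≡ level v
hamming-𝟎ˡ []          = refl
hamming-𝟎ˡ (true ∷ v)  = cong suc (hamming-𝟎ˡ v)
hamming-𝟎ˡ (false ∷ v) = hamming-𝟎ˡ v

level-++ : ∀ {j k} (s : Vertex j) (x : Vertex k) → level (s ++ x) ≡ level s + level x
level-++ []          x = refl
level-++ (true ∷ s)  x = cong suc (level-++ s x)
level-++ (false ∷ s) x = level-++ s x

level≡0⇒≡𝟎 : ∀ {n} (v : Vertex n) → level v ≡ 0 → v ≡ 𝟎
level≡0⇒≡𝟎 []          _  = refl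
level≡0⇒≡𝟎 (false ∷ v) eq = cong (false ∷_) (level≡0⇒≡𝟎 v eq)

𝟎-++-𝟎 : ∀ j k → 𝟎 {j} ++ 𝟎 {k} ≡ 𝟎
𝟎-++-𝟎 zero    k = refl
𝟎-++-𝟎 (suc j) k = cong (false ∷_) (𝟎-++-𝟎 j k)

𝟎≢-++ : ∀ {j k} (s : Vertex j) (x : Vertex k) → 1 ≤ level s → 𝟎 ≢ s ++ x
𝟎≢-++ (true ∷ s)  x _     ()
𝟎≢-++ (false ∷ s) x 1≤|s| eq = 𝟎≢-++ s x 1≤|s| (∷-injectiveʳ eq)

translate : ∀ {n} → Vertex n → Vertex n → Vertex n
translate = zipWith _xor_

translate-involutive : ∀ {n} (r x : Vertex n) → translate r (translate r x) ≡ x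
translate-involutive []          []      = refl
translate-involutive (false ∷ r) (b ∷ x) = cong (b ∷_) (translate-involutive r x)
translate-involutive (true ∷ r)  (b ∷ x) = cong₂ _∷_ (not-involutive b) (translate-involutive r x)

translate-𝟎 : ∀ {n} (r : Vertex n) → translate r 𝟎 ≡ r
translate-𝟎 = zipWith-identityʳ xor-identityʳ

hamming-translate : ∀ {n} (r x y : Vertex n) → hamming (translate r x) (translate r y) ≡ hamming x y
hamming-translate []          []       []       = refl
hamming-translate (false ∷ r) (_ ∷ xs) (_ ∷ ys) = cong (_ +_) (hamming-translate r xs ys)
hamming-translate (true ∷ r)  (x ∷ xs) (y ∷ ys) =
  cong₂ (λ b n → (if b then 0 else 1) + n) (does-not-≟ x y) (hamming-translate r xs ys)
  where
  does-not-≟ : ∀ a b → does (not a ≟B not b) ≡ does (a ≟B b)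
  does-not-≟ true  true  = refl
  does-not-≟ true  false = refl
  does-not-≟ false true  = refl
  does-not-≟ false false = refl

take-toList-++ : ∀ {j k} (s : Vertex j) (x : Vertex k) → List.take j (toList (s ++ x)) ≡ toList s
take-toList-++ []      x = refl
take-toList-++ (b ∷ s) x = cong (b ∷_) (take-toList-++ s x)

take-toList≡⇒++ : ∀ {j k} (s : Vertex j) (w : Vertex (j + k)) →
                  List.take j (toList w) ≡ toList s → ∃ λ x → s ++ x ≡ w
take-toList≡⇒++ []      w _  = w , refl
take-toList≡⇒++ (b ∷ s) (c ∷ w) eq with take-toList≡⇒++ s w (ListP.∷-injectiveʳ eq)
... | x , refl = x , cong (_∷ (s ++ x)) (sym (ListP.∷-injectiveˡ eq))

kCube-++ : ∀ {j k} (s : Vertex j) (x : Vertex k) → kCube s (s ++ x) ≡ true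
kCube-++ {j} s x =
  dec-true (ListP.≡-dec _≟B_ (List.take j (toList (s ++ x))) (toList s)) (take-toList-++ s x)

kCube-sound : ∀ {j k} (s : Vertex j) (w : Vertex (j + k)) → kCube s w ≡ true → ∃ λ x → s ++ x ≡ w
kCube-sound {j} s w w∈cube with ListP.≡-dec _≟B_ (List.take j (toList w)) (toList s)
... | yes eq = take-toList≡⇒++ s w eq
kCube-sound s w () | no _

Q : ℕ → DistanceSpace
Q n = record
  { Point      = Vertex n
  ; _≟_        = _≟V_
  ; exhaustive = Vec-exhaustible Bool-exhaustible n
  ; dist       = hamming
  }

apexDist : ∀ {k} → ℕ → Maybe (Vertex k) → Maybe (Vertex k) → ℕ
apexDist l nothing  nothing  = 0
apexDist l nothing  (just y) = l + level y
apexDist l (just x) nothing  = l + level x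
apexDist l (just x) (just y) = hamming x y

-- nothing is 𝟎 and just x is the vertex (s, x) of a k-cube with label s of level l.
LevelCube : ℕ → ℕ → DistanceSpace
LevelCube k l = record
  { Point      = Maybe (Vertex k)
  ; _≟_        = MaybeP.≡-dec _≟V_
  ; exhaustive = Maybe-exhaustible (Vec-exhaustible Bool-exhaustible k)
  ; dist       = apexDist l
  }

open CupStacking using (Wins; wins; IsometricEmbedding)
open IsometricEmbedding using (embed)

translation : ∀ {n} → Vertex n → IsometricEmbedding (Q n) n
translation r = record
  { embed     = translate r
  ; injective = λ {x} {y} eq →
      trans (sym (translate-involutive r x)) (trans (cong (translate r) eq) (translate-involutive r y))
  ; isometric = hamming-translate r
  }

prefixing : ∀ {j k} → Vertex j → IsometricEmbedding (Q k) (j + k)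
prefixing s = record
  { embed     = s ++_
  ; injective = ++-injectiveʳ s s
  ; isometric = hamming-++ s
  }

levelCubeEmbedding : ∀ {j k l} (s : Vertex j) → level s ≡ l → 1 ≤ l →
                     IsometricEmbedding (LevelCube k l) (j + k)
levelCubeEmbedding {j} {k} {l} s level-s 1≤l =
  record { embed = apex ; injective = injective ; isometric = isometric }
  where
  apex : Maybe (Vertex k) → Vertex (j + k)
  apex nothing  = 𝟎
  apex (just x) = s ++ x

  1≤|s| : 1 ≤ level s
  1≤|s| = subst (1 ≤_) (sym level-s) 1≤l

  level-s++ : ∀ x → level (s ++ x) ≡ l + level x
  level-s++ x = trans (level-++ s x) (cong (_+ level x) level-s)

  injective : ∀ {p q} → apex p ≡ apex q → p ≡ q
  injective {nothing} {nothing} _  = refl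
  injective {nothing} {just y}  eq = ⊥-elim (𝟎≢-++ s y 1≤|s| eq)
  injective {just x}  {nothing} eq = ⊥-elim (𝟎≢-++ s x 1≤|s| (sym eq))
  injective {just x}  {just y}  eq = cong just (++-injectiveʳ s s eq)

  isometric : ∀ p q → hamming (apex p) (apex q) ≡ apexDist l p q
  isometric nothing  nothing  = hamming-self (𝟎 {j + k})
  isometric nothing  (just y) = trans (hamming-𝟎ˡ (s ++ y)) (level-s++ y)
  isometric (just x) nothing  = trans (hamming-𝟎ʳ (s ++ x)) (level-s++ x)
  isometric (just x) (just y) = hamming-++ s x y

stackable : ∀ {n ms} → Wins (Q n) 𝟎 ms → Stackable n
stackable {n} win r =
  let C , reach , allOn = stack win represents
  in  C , reach , subst (λ t → AllOn t C) (translate-𝟎 r) allOn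
  where
  open CupStacking (Q n) using (Represents; oneEach)
  open CupStacking.Simulation (Q n) (translation r) using (stack)
  represents : Represents (translate r) (λ _ → 1) oneEach
  represents = record
    { agrees        = λ _ → refl
    ; support⊆image = λ w _ → translate r w , translate-involutive r w
    }

zeroStackable-along : ∀ {X d z ms} (e : IsometricEmbedding X d) (U : VSet d) →
                      Wins X z ms → embed e z ≡ 𝟎 →
                      (∀ p → U (embed e p) ≡ true ⊎ embed e p ≡ 𝟎) →
                      (∀ w → U w ≡ true ⊎ w ≡ 𝟎 → ∃ λ p → embed e p ≡ w) →
                      ZeroStackable U
zeroStackable-along {X} e U win z↦𝟎 image⊆ ⊆image =
  let C , reach , allOn = stack win (represents-initConfig (embed e) U image⊆ ⊆image)
  in  C , reach , subst (λ t → AllOn t C) z↦𝟎 allOn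
  where
  open CupStacking X using (represents-initConfig)
  open CupStacking.Simulation X e using (stack)

level0-zeroStackable : ∀ {j k ms} → Wins (Q k) 𝟎 ms →
                       (s : Vertex j) → level s ≡ 0 → ZeroStackable {j + k} (kCube s)
level0-zeroStackable {j} {k} win s level-s =
  zeroStackable-along (prefixing s) (kCube s) win s++𝟎≡𝟎
    (λ x → inj₁ (kCube-++ s x))
    λ { w (inj₁ w∈cube) → kCube-sound s w w∈cube
      ; w (inj₂ refl)   → 𝟎 , s++𝟎≡𝟎 }
  where
  s++𝟎≡𝟎 : s ++ 𝟎 ≡ 𝟎
  s++𝟎≡𝟎 = trans (cong (_++ 𝟎) (level≡0⇒≡𝟎 s level-s)) (𝟎-++-𝟎 j k)

level-zeroStackable : ∀ {j k l ms} → 1 ≤ l → Wins (LevelCube k l) nothing ms →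
                      (s : Vertex j) → level s ≡ l → ZeroStackable {j + k} (kCube s)
level-zeroStackable 1≤l win s level-s =
  zeroStackable-along (levelCubeEmbedding s level-s 1≤l) (kCube s) win refl
    (λ { nothing → inj₂ refl ; (just x) → inj₁ (kCube-++ s x) })
    λ { w (inj₁ w∈cube) → let x , eq = kCube-sound s w w∈cube in just x , eq
      ; w (inj₂ refl)   → nothing , refl }

-- Winning plays

-- Vertex m of Q^n is the binary expansion of m, most significant coordinate first.
bits : ∀ n → ℕ → Vertex n
bits zero    _ = []
bits (suc n) m = bits n (m / 2) ∷ʳ (m % 2 ≡ᵇ 1)

cubePlay : ∀ n → List (ℕ × ℕ) → List (Vertex n × Vertex n)
cubePlay n = List.map (Product.map (bits n) (bits n))

levelPlay : ∀ k → List (ℕ × Maybe ℕ) → List (Maybe (Vertex k) × Maybe (Vertex k))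
levelPlay k = List.map (Product.map (just ∘ bits k) (Maybe.map (bits k)))

cube-wins : ∀ n → n ≤ 6 → ∃ (Wins (Q n) 𝟎)
cube-wins 0 _ = _ , wins (Q 0) 𝟎 (cubePlay 0 [])
cube-wins 1 _ = _ , wins (Q 1) 𝟎 (cubePlay 1
  ((1 , 0) ∷ []))
cube-wins 2 _ = _ , wins (Q 2) 𝟎 (cubePlay 2
  ((1 , 0) ∷ (2 , 3) ∷ (3 , 0) ∷ []))
cube-wins 3 _ = _ , wins (Q 3) 𝟎 (cubePlay 3
  ((1 , 0) ∷ (2 , 0) ∷ (3 , 7) ∷ (5 , 7) ∷ (7 , 0) ∷ (4 , 6) ∷ (6 , 0) ∷ []))
cube-wins 4 _ = _ , wins (Q 4) 𝟎 (cubePlay 4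
  ((1 , 0) ∷ (2 , 0) ∷ (4 , 0) ∷ (8 , 0) ∷ (3 , 7) ∷ (5 , 7) ∷ (7 , 0) ∷ (6 , 14) ∷ (10 , 14) ∷
    (14 , 0) ∷ (9 , 11) ∷ (15 , 11) ∷ (11 , 0) ∷ (13 , 12) ∷ (12 , 0) ∷ []))
cube-wins 5 _ = _ , wins (Q 5) 𝟎 (cubePlay 5
  ((1 , 0) ∷ (2 , 0) ∷ (4 , 0) ∷ (8 , 0) ∷ (16 , 0) ∷ (3 , 7) ∷ (5 , 7) ∷ (7 , 0) ∷ (6 , 14) ∷
    (10 , 14) ∷ (14 , 0) ∷ (9 , 11) ∷ (11 , 13) ∷ (13 , 0) ∷ (12 , 28) ∷ (20 , 28) ∷ (28 , 0) ∷
    (15 , 31) ∷ (23 , 31) ∷ (27 , 31) ∷ (29 , 31) ∷ (31 , 0) ∷ (17 , 19) ∷ (18 , 19) ∷ (19 , 0) ∷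
    (24 , 25) ∷ (25 , 21) ∷ (21 , 0) ∷ (30 , 22) ∷ (22 , 26) ∷ (26 , 0) ∷ []))
cube-wins 6 _ = _ , wins (Q 6) 𝟎 (cubePlay 6
  ((1 , 0) ∷ (2 , 0) ∷ (3 , 7) ∷ (5 , 7) ∷ (7 , 0) ∷ (4 , 6) ∷ (6 , 0) ∷ (8 , 0) ∷ (9 , 11) ∷
    (10 , 11) ∷ (11 , 0) ∷ (13 , 12) ∷ (12 , 15) ∷ (14 , 15) ∷ (15 , 0) ∷ (16 , 0) ∷ (17 , 19) ∷
    (18 , 19) ∷ (19 , 0) ∷ (21 , 20) ∷ (20 , 23) ∷ (22 , 23) ∷ (23 , 0) ∷ (24 , 25) ∷ (25 , 26) ∷
    (26 , 0) ∷ (27 , 31) ∷ (29 , 31) ∷ (30 , 28) ∷ (28 , 31) ∷ (31 , 0) ∷ (32 , 0) ∷ (33 , 35) ∷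
    (34 , 35) ∷ (35 , 0) ∷ (37 , 36) ∷ (36 , 39) ∷ (38 , 39) ∷ (39 , 0) ∷ (40 , 41) ∷ (41 , 42) ∷
    (42 , 0) ∷ (43 , 47) ∷ (45 , 47) ∷ (46 , 44) ∷ (44 , 47) ∷ (47 , 0) ∷ (48 , 49) ∷ (49 , 50) ∷
    (50 , 0) ∷ (51 , 55) ∷ (53 , 55) ∷ (54 , 52) ∷ (52 , 55) ∷ (55 , 0) ∷ (56 , 57) ∷ (57 , 58) ∷
    (59 , 58) ∷ (58 , 0) ∷ (61 , 60) ∷ (62 , 63) ∷ (63 , 60) ∷ (60 , 0) ∷ []))
cube-wins (suc (suc (suc (suc (suc (suc (suc _))))))) (s≤s (s≤s (s≤s (s≤s (s≤s (s≤s ()))))))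

levelCube-wins : ∀ k l → k ≤ 3 → 1 ≤ l → l ≤ 2 ^ k → (k ≡ 3 → l ≢ 4) →
                 ∃ (Wins (LevelCube k l) nothing)
levelCube-wins _ 0 _ () _ _
levelCube-wins 0 1 _ _ _ _ = _ , wins (LevelCube 0 1) nothing (levelPlay 0
  ((0 , nothing) ∷ []))
levelCube-wins 0 (suc (suc _)) _ _ (s≤s ()) _
levelCube-wins 1 1 _ _ _ _ = _ , wins (LevelCube 1 1) nothing (levelPlay 1
  ((0 , just 1) ∷ (1 , nothing) ∷ []))
levelCube-wins 1 2 _ _ _ _ = _ , wins (LevelCube 1 2) nothing (levelPlay 1
  ((1 , just 0) ∷ (0 , nothing) ∷ []))
levelCube-wins 1 (suc (suc (suc _))) _ _ (s≤s (s≤s ())) _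
levelCube-wins 2 1 _ _ _ _ = _ , wins (LevelCube 2 1) nothing (levelPlay 2
  ((0 , nothing) ∷ (1 , just 3) ∷ (2 , just 3) ∷ (3 , nothing) ∷ []))
levelCube-wins 2 2 _ _ _ _ = _ , wins (LevelCube 2 2) nothing (levelPlay 2
  ((1 , just 0) ∷ (0 , just 3) ∷ (2 , just 3) ∷ (3 , nothing) ∷ []))
levelCube-wins 2 3 _ _ _ _ = _ , wins (LevelCube 2 3) nothing (levelPlay 2
  ((0 , just 1) ∷ (1 , just 2) ∷ (3 , just 2) ∷ (2 , nothing) ∷ []))
levelCube-wins 2 4 _ _ _ _ = _ , wins (LevelCube 2 4) nothing (levelPlay 2
  ((1 , just 0) ∷ (2 , just 3) ∷ (3 , just 0) ∷ (0 , nothing) ∷ []))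
levelCube-wins 2 (suc (suc (suc (suc (suc _))))) _ _ (s≤s (s≤s (s≤s (s≤s ())))) _
levelCube-wins 3 1 _ _ _ _ = _ , wins (LevelCube 3 1) nothing (levelPlay 3
  ((0 , nothing) ∷ (1 , just 3) ∷ (2 , just 3) ∷ (3 , nothing) ∷ (5 , just 4) ∷ (4 , just 7) ∷
    (6 , just 7) ∷ (7 , nothing) ∷ []))
levelCube-wins 3 2 _ _ _ _ = _ , wins (LevelCube 3 2) nothing (levelPlay 3
  ((0 , just 1) ∷ (1 , just 2) ∷ (2 , nothing) ∷ (3 , just 7) ∷ (5 , just 7) ∷ (6 , just 4) ∷
    (4 , just 7) ∷ (7 , nothing) ∷ []))
levelCube-wins 3 3 _ _ _ _ = _ , wins (LevelCube 3 3) nothing (levelPlay 3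
  ((0 , just 1) ∷ (1 , just 2) ∷ (3 , just 2) ∷ (2 , nothing) ∷ (5 , just 4) ∷ (6 , just 7) ∷
    (7 , just 4) ∷ (4 , nothing) ∷ []))
levelCube-wins 3 4 _ _ _ l≢4 = ⊥-elim (l≢4 refl refl)
levelCube-wins 3 5 _ _ _ _ = _ , wins (LevelCube 3 5) nothing (levelPlay 3
  ((0 , just 1) ∷ (1 , just 7) ∷ (3 , just 7) ∷ (5 , just 4) ∷ (4 , just 7) ∷ (6 , just 2) ∷
    (2 , just 7) ∷ (7 , nothing) ∷ []))
levelCube-wins 3 6 _ _ _ _ = _ , wins (LevelCube 3 6) nothing (levelPlay 3
  ((0 , just 1) ∷ (1 , just 2) ∷ (2 , just 5) ∷ (4 , just 6) ∷ (6 , just 5) ∷ (7 , just 3) ∷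
    (3 , just 5) ∷ (5 , nothing) ∷ []))
levelCube-wins 3 7 _ _ _ _ = _ , wins (LevelCube 3 7) nothing (levelPlay 3
  ((0 , just 1) ∷ (1 , just 2) ∷ (3 , just 2) ∷ (6 , just 2) ∷ (4 , just 5) ∷ (7 , just 5) ∷
    (5 , just 2) ∷ (2 , nothing) ∷ []))
levelCube-wins 3 8 _ _ _ _ = _ , wins (LevelCube 3 8) nothing (levelPlay 3
  ((1 , just 0) ∷ (2 , just 0) ∷ (3 , just 7) ∷ (5 , just 7) ∷ (7 , just 0) ∷ (4 , just 6) ∷
    (6 , just 0) ∷ (0 , nothing) ∷ []))
levelCube-wins 3 (suc (suc (suc (suc (suc (suc (suc (suc (suc _))))))))) _ _ (s≤s (s≤s (s≤s (s≤s (s≤s (s≤s (s≤s (s≤s ())))))))) _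
levelCube-wins (suc (suc (suc (suc _)))) _ (s≤s (s≤s (s≤s ()))) _ _ _

kCube-zeroStackable : ∀ k l → k ≤ 3 → l ≤ 2 ^ k → (k ≡ 3 → l ≢ 4) →
                      ∀ {j} (s : Vertex j) → level s ≡ l → ZeroStackable {j + k} (kCube s)
kCube-zeroStackable k zero k≤3 _ _ =
  level0-zeroStackable (proj₂ (cube-wins k (≤-trans k≤3 (m≤m+n 3 3))))
kCube-zeroStackable k l@(suc _) k≤3 l≤2^k l≢4 =
  level-zeroStackable (s≤s z≤n) (proj₂ (levelCube-wins k l k≤3 (s≤s z≤n) l≤2^k l≢4))

lemma22 : (∀ (k l d : ℕ) → k ≤ 3 → l ≤ 2 ^ k → l + k ≤ d → (k ≡ 3 → l ≢ 4) →
              ∀ (s : Vec Bool (d ∸ k)) → level s ≡ l →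
              ZeroStackable {d} (kCube s))
            × (∀ (d : ℕ) → d ≤ 6 → Stackable d)
lemma22 =
    (λ k l d k≤3 l≤2^k l+k≤d l≢4 s level-s →
       subst (λ d′ → ZeroStackable {d′} (kCube s)) (m∸n+n≡m (≤-trans (m≤n+m k l) l+k≤d))
             (kCube-zeroStackable k l k≤3 l≤2^k l≢4 s level-s))
  , λ d d≤6 → stackable (proj₂ (cube-wins d d≤6))
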